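{- The normal suspense number $S^+$ of paths is non-decreasing in $n$, and for every $n\ge 0$: 1. $S^+(P_{5(2^n-1)})=2n$; 2. $S^+(P_k)=2n+1$ for every $k$ with $5(2^n-1)+1\le k\le 5(2^{n+1}-1)-2$; 3. $S^+(P_{5(2^{n+1}-1)-1})=2n+2$.
   Context: For $n\ge 0$, $P_n$ denotes the path on $n$ vertices ($P_0$ is the empty graph). A Node-Kayles move on a path $P_k$ with $k\ge 1$ chooses a vertex and deletes it together with its neighbours. The possible results are: $P_0$ if $k\in\{1,2\}$; $P_0$ or $P_1$ if $k=3$; and, for $k\ge 4$, $P_{k-2}$, $P_{k-3}$, or two paths $P_i,P_j$ with $j\ge i\ge1$, $i+j=k-3$. In the continued conjunctive compound game, a position $G$ is a finite multiset of paths (components). A move replaces every nonempty component simultaneously by the result of a Node-Kayles move on it; a split component yields two components. The set $O(G)$ of options of $G$ consists of all positions obtainable by one such move, and $O(G)=\emptyset$ exactly when all components are empty. The normal suspense number $S^+$ is defined recursively as follows: - $S^+(G)=0$ if $O(G)=\emptyset$; - $S^+(G)=1+\max\{S^+(G'):G'\in O(G),\ S^+(G')\text{ even}\}$ if some option has even suspense number; - $S^+(G)=1+\min\{S^+(G'):G'\in O(G)\}$ otherwise, in which case all these values are odd. $S^+(P_n)$ denotes the suspense number of the single component $P_n$. -}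

module Defs where

open import Data.Nat using (ℕ; zero; suc; _+_; _∸_; _⊔_; _⊓_)
open import Data.Bool using (Bool; true; false)
open import Data.List using (List; []; _∷_; map; concatMap; filter; foldr; _++_)
open import Data.Nat.ListAction using (sum)
open import Data.Nat.Properties using (_≟_)
open import Relation.Nullary using (¬?)

-- A position: a finite multiset of paths, represented as a list of path
-- lengths (order is irrelevant; the entry k stands for the path P_k).
Position : Set
Position = List ℕ

path : ℕ → Position
path n = n ∷ []

splitsAux : ℕ → ℕ → ℕ → List Position
splitsAux zero    i m = []
splitsAux (suc f) i m with (i + i) Data.Nat.≤? m
... | Relation.Nullary.yes _ = (i ∷ (m ∸ i) ∷ []) ∷ splitsAux f (suc i) m
... | Relation.Nullary.no  _ = []

splits : ℕ → List Position
splits m = splitsAux m 1 m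

-- Node-Kayles move results on a single nonempty path P_k
-- (each result is the list of resulting components; P_0 is the empty list).
nkMoves : ℕ → List Position
nkMoves zero                   = []
nkMoves (suc zero)             = [] ∷ []
nkMoves (suc (suc zero))       = [] ∷ []
nkMoves (suc (suc (suc zero))) = [] ∷ (1 ∷ []) ∷ []
nkMoves k@(suc (suc (suc (suc _)))) =
  path (k ∸ 2) ∷ path (k ∸ 3) ∷ splits (k ∸ 3)

-- All ways to move simultaneously in every component of a list of
-- nonempty components.
allMoves : List ℕ → List Position
allMoves []       = [] ∷ []
allMoves (k ∷ ks) =
  concatMap (λ r → map (λ rest → r ++ rest) (allMoves ks)) (nkMoves k)

options : Position → List Position
options G with filter (λ k → ¬? (k ≟ 0)) G
... | []       = []
... | (k ∷ ks) = allMoves (k ∷ ks)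

isEven : ℕ → Bool
isEven zero          = true
isEven (suc zero)    = false
isEven (suc (suc n)) = isEven n

evens : List ℕ → List ℕ
evens []       = []
evens (x ∷ xs) with isEven x
... | true  = x ∷ evens xs
... | false = evens xs

-- Suspense-number recursion with an explicit fuel parameter.
-- Every move removes at least one vertex, so fuel (1 + total vertices)
-- suffices for the recursion to reach terminal positions.
suspenseF : ℕ → Position → ℕ
suspenseF zero    G = 0
suspenseF (suc f) G with options G
... | []       = 0
... | (o ∷ os) with map (suspenseF f) (o ∷ os)
...   | vs with evens vs
...     | []       = suc (foldr _⊓_ (suspenseF f o) vs)
...     | (e ∷ es) = suc (foldr _⊔_ e es)

size : Position → ℕ
size = sum

S⁺ : Position → ℕ
S⁺ G = suspenseF (suc (size G)) G

-- Write aₙ = 5(2ⁿ − 1), so that a₀ = 0 and aₙ₊₁ = 2aₙ + 5, and let σ k be the value claimed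
-- for S⁺(P_k): 2n at aₙ, 2n + 1 on [aₙ + 1, 2aₙ + 3], and 2n + 2 at 2aₙ + 4 = aₙ₊₁ − 1.
-- We show that S⁺ of every position is the maximum of σ over its components, by induction on
-- the number of vertices.  Unfolding the definition, S⁺ G = t + 1 as soon as t is the value
-- of some option, bounds the values of all even options, and, when t is odd, is a lower
-- bound of all option values.  This condition is preserved by the product of option sets
-- produced by a conjunctive move, t being combined by max, so it only has to be checked for a
-- single path.  There it follows from two facts about a Node-Kayles move on P_k: all
-- remaining components have at most k − 2 vertices, and one of them has at least (k − 3)/2.
module Submission where

open import Defs
open import Data.Bool using (true; false; not)
open import Data.List using (List; []; _∷_; map; filter; foldr; _++_)
open import Data.List.Membership.Propositional using (_∈_; find; lose)
open import Data.List.Membership.Propositional.Properties using (∈-map⁺; ∈-map⁻; ∈-concatMap⁺; ∈-concatMap⁻)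
open import Data.List.Properties using (map-cong-local)
open import Data.List.Relation.Unary.All using (All; []; _∷_; tabulate)
open import Data.List.Relation.Unary.All.Properties using (all-filter)
open import Data.List.Relation.Unary.Any using (here; there)
open import Data.Nat using (ℕ; zero; suc; _+_; _*_; _∸_; _^_; _≤_; _<_; _⊔_; _⊓_; z≤n; s≤s; s≤s⁻¹; z<s; s<s; _≤′_; ≤′-refl; ≤′-step; pred; _≤?_; _<?_; _≟_; >-nonZero)
open import Data.Nat.ListAction.Properties using (sum-++)
open import Data.Nat.Properties
open import Data.Nat.Tactic.RingSolver using (solve-∀)
open import Data.Product using (_×_; _,_; ∃-syntax; ∃₂)
open import Data.Sum using (inj₁; inj₂)
open import Function using (_∘_)
open import Relation.Nullary using (¬_; yes; no; ¬?; contradiction)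
open import Relation.Binary.PropositionalEquality

isEven-suc : ∀ n → isEven (suc n) ≡ not (isEven n)
isEven-suc zero          = refl
isEven-suc (suc zero)    = refl
isEven-suc (suc (suc n)) = isEven-suc n

isEven-2* : ∀ n → isEven (2 * n) ≡ true
isEven-2* zero    = refl
isEven-2* (suc n) rewrite *-suc 2 n = isEven-2* n

isEven-1+2* : ∀ n → isEven (suc (2 * n)) ≡ false
isEven-1+2* n = trans (isEven-suc (2 * n)) (cong not (isEven-2* n))

even-≤-odd : ∀ {x n} → isEven x ≡ true → x ≤ suc (2 * n) → x ≤ 2 * n
even-≤-odd {n = n} even x≤ with m≤n⇒m<n∨m≡n x≤
... | inj₁ x< = s≤s⁻¹ x<
... | inj₂ refl = contradiction (trans (sym even) (isEven-1+2* n)) λ ()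

-- Node-Kayles moves on a path

∈-splitsAux⁻ : ∀ {r} f i m → 1 ≤ i → r ∈ splitsAux f i m →
               ∃[ a ] r ≡ a ∷ (m ∸ a) ∷ [] × 1 ≤ a × a + a ≤ m
∈-splitsAux⁻ (suc f) i m 1≤i r∈ with i + i ≤? m
∈-splitsAux⁻ (suc f) i m 1≤i (here refl) | yes i+i≤m = i , refl , 1≤i , i+i≤m
∈-splitsAux⁻ (suc f) i m 1≤i (there r∈)  | yes _     = ∈-splitsAux⁻ f (suc i) m (m≤n⇒m≤1+n 1≤i) r∈

∈-splitsAux⁺ : ∀ f i m {a} → i ≤ a → a + a ≤ m → a < i + f →
               (a ∷ (m ∸ a) ∷ []) ∈ splitsAux f i m
∈-splitsAux⁺ zero i m {a} i≤a _ a<i+0 = contradiction i≤a (<⇒≱ (subst (a <_) (+-identityʳ i) a<i+0))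
∈-splitsAux⁺ (suc f) i m {a} i≤a a+a≤m a< with i + i ≤? m
... | no i+i≰m = contradiction (≤-trans (+-mono-≤ i≤a i≤a) a+a≤m) i+i≰m
... | yes _ with m≤n⇒m<n∨m≡n i≤a
...   | inj₂ refl = here refl
...   | inj₁ i<a  = there (∈-splitsAux⁺ f (suc i) m i<a a+a≤m (subst (a <_) (+-suc i f) a<))

∈-splits⁻ : ∀ {r m} → r ∈ splits m → ∃₂ λ a b → r ≡ a ∷ b ∷ [] × 1 ≤ a × a ≤ b × a + b ≡ m
∈-splits⁻ {m = m} r∈ with ∈-splitsAux⁻ m 1 m ≤-refl r∈
... | a , refl , 1≤a , a+a≤m = a , m ∸ a , refl , 1≤a , a≤m∸a , a+[m∸a]≡m
  where
  a+[m∸a]≡m : a + (m ∸ a) ≡ m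
  a+[m∸a]≡m = m+[n∸m]≡n (≤-trans (m≤m+n a a) a+a≤m)
  a≤m∸a : a ≤ m ∸ a
  a≤m∸a = +-cancelˡ-≤ a a (m ∸ a) (subst (a + a ≤_) (sym a+[m∸a]≡m) a+a≤m)

∈-splits⁺ : ∀ {a b} → 1 ≤ a → a ≤ b → (a ∷ b ∷ []) ∈ splits (a + b)
∈-splits⁺ {a} {b} 1≤a a≤b = subst (λ x → (a ∷ x ∷ []) ∈ splits (a + b)) (m+n∸m≡n a b)
  (∈-splitsAux⁺ (a + b) 1 (a + b) 1≤a (+-monoʳ-≤ a a≤b) (s≤s (m≤m+n a b)))

-- The results of a move on the path with 4 + m vertices.
data Move (m : ℕ) : Position → Set where
  end   : Move m (path (2 + m))
  next  : Move m (path (1 + m))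
  split : ∀ {a b} → 1 ≤ a → a ≤ b → a + b ≡ 1 + m → Move m (a ∷ b ∷ [])

move : ∀ {m r} → r ∈ nkMoves (4 + m) → Move m r
move (here refl)         = end
move (there (here refl)) = next
move (there (there r∈)) with ∈-splits⁻ r∈
... | _ , _ , refl , 1≤a , a≤b , a+b≡ = split 1≤a a≤b a+b≡

path∈nkMoves[2+] : ∀ {j} → 2 ≤ j → path j ∈ nkMoves (2 + j)
path∈nkMoves[2+] (s≤s (s≤s _)) = here refl

path∈nkMoves[3+] : ∀ {j} → 1 ≤ j → path j ∈ nkMoves (3 + j)
path∈nkMoves[3+] (s≤s _) = there (here refl)

pair∈nkMoves : ∀ {a b} → 1 ≤ a → a ≤ b → (a ∷ b ∷ []) ∈ nkMoves (3 + (a + b))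
pair∈nkMoves 1≤a@(s≤s _) a≤b = there (there (∈-splits⁺ 1≤a a≤b))

size-nkMoves : ∀ {k r} → r ∈ nkMoves k → size r < k
size-nkMoves {1} (here refl)         = z<s
size-nkMoves {2} (here refl)         = z<s
size-nkMoves {3} (here refl)         = z<s
size-nkMoves {3} (there (here refl)) = s<s z<s
size-nkMoves {suc (suc (suc (suc m)))} r∈ with move r∈
... | end  = ≤-<-trans (≤-reflexive (+-identityʳ (2 + m))) (+-monoˡ-< m (s<s (s<s z<s)))
... | next = ≤-<-trans (≤-reflexive (+-identityʳ (1 + m))) (+-monoˡ-< m (s<s z<s))
... | split {a} {b} _ _ a+b≡ =
  ≤-<-trans (≤-reflexive (trans (cong (a +_) (+-identityʳ b)) a+b≡)) (+-monoˡ-< m (s<s z<s))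

nkMoves-component : ∀ {k r c} → r ∈ nkMoves k → c ∈ r → 2 + c ≤ k
nkMoves-component {1} (here refl) ()
nkMoves-component {2} (here refl) ()
nkMoves-component {3} (here refl) ()
nkMoves-component {3} (there (here refl)) (here refl) = ≤-refl
nkMoves-component {3} (there (here refl)) (there ())
nkMoves-component {suc (suc (suc (suc m)))} r∈ c∈ with move r∈ | c∈
... | end  | here refl = ≤-refl
... | next | here refl = n≤1+n _
... | split {a} {b} _ a≤b a+b≡ | here refl =
  +-monoʳ-≤ 2 (≤-trans (≤-trans (m≤m+n a b) (≤-reflexive a+b≡)) (n≤1+n _))
... | split {a} {b} _ a≤b a+b≡ | there (here refl) =
  +-monoʳ-≤ 2 (≤-trans (≤-trans (m≤n+m b a) (≤-reflexive a+b≡)) (n≤1+n _))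

nkMoves-large : ∀ {k r} → 4 ≤ k → r ∈ nkMoves k → ∃[ c ] c ∈ r × k ≤ 3 + (c + c)
nkMoves-large {suc (suc (suc (suc m)))} (s≤s (s≤s (s≤s (s≤s _)))) r∈ with move r∈
... | end  = 2 + m , here refl , +-monoʳ-≤ 3 (≤-trans (n≤1+n (1 + m)) (m≤m+n (2 + m) (2 + m)))
... | next = 1 + m , here refl , +-monoʳ-≤ 3 (m≤m+n (1 + m) (1 + m))
... | split {a} {b} _ a≤b a+b≡ = b , there (here refl) , +-monoʳ-≤ 3 (subst (_≤ b + b) a+b≡ (+-monoˡ-≤ b a≤b))

∈-allMoves⁻ : ∀ k ks {o} → o ∈ allMoves (k ∷ ks) →
              ∃₂ λ r s → r ∈ nkMoves k × s ∈ allMoves ks × o ≡ r ++ s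
∈-allMoves⁻ _ _ o∈ with find (∈-concatMap⁻ _ o∈)
... | r , r∈ , o∈rs with ∈-map⁻ (r ++_) o∈rs
...   | s , s∈ , refl = r , s , r∈ , s∈ , refl

∈-allMoves⁺ : ∀ k ks {r s} → r ∈ nkMoves k → s ∈ allMoves ks → r ++ s ∈ allMoves (k ∷ ks)
∈-allMoves⁺ _ _ {r} r∈ s∈ = ∈-concatMap⁺ _ (lose r∈ (∈-map⁺ (r ++_) s∈))

size-allMoves : ∀ cs {o} → o ∈ allMoves cs → size o ≤ size cs
size-allMoves [] (here refl) = z≤n
size-allMoves (k ∷ ks) o∈ with ∈-allMoves⁻ k ks o∈
... | r , s , r∈ , s∈ , refl =
  ≤-trans (≤-reflexive (sum-++ r s)) (+-mono-≤ (<⇒≤ (size-nkMoves r∈)) (size-allMoves ks s∈))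

movesOf : List ℕ → List Position
movesOf []       = []
movesOf (k ∷ ks) = allMoves (k ∷ ks)

size-movesOf : ∀ cs {o} → o ∈ movesOf cs → size o < size cs
size-movesOf (k ∷ ks) o∈ with ∈-allMoves⁻ k ks o∈
... | r , s , r∈ , s∈ , refl =
  ≤-<-trans (≤-reflexive (sum-++ r s)) (+-mono-<-≤ (size-nkMoves r∈) (size-allMoves ks s∈))

nonzero : Position → Position
nonzero = filter (λ k → ¬? (k ≟ 0))

options≡movesOf : ∀ G → options G ≡ movesOf (nonzero G)
options≡movesOf G with filter (λ k → ¬? (k ≟ 0)) G
... | []     = refl
... | k ∷ ks = refl

size-nonzero : ∀ G → size (nonzero G) ≤ size G
size-nonzero []          = z≤n
size-nonzero (zero ∷ G)  = size-nonzero G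
size-nonzero (suc k ∷ G) = +-monoʳ-≤ (suc k) (size-nonzero G)

suspenseStep : List ℕ → ℕ
suspenseStep []       = 0
suspenseStep (v ∷ vs) with evens (v ∷ vs)
... | []     = suc (foldr _⊓_ v (v ∷ vs))
... | e ∷ es = suc (foldr _⊔_ e es)

suspenseF-suc : ∀ f G → suspenseF (suc f) G ≡ suspenseStep (map (suspenseF f) (options G))
suspenseF-suc f G with options G
... | []     = refl
... | o ∷ os with evens (suspenseF f o ∷ map (suspenseF f) os)
...   | []     = refl
...   | e ∷ es = refl

∈-evens⁻ : ∀ {x vs} → x ∈ evens vs → x ∈ vs × isEven x ≡ true
∈-evens⁻ {vs = y ∷ vs} x∈ with isEven y in even
∈-evens⁻ (here refl) | true = here refl , even
∈-evens⁻ (there x∈)  | true with ∈-evens⁻ x∈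
... | x∈vs , x-even = there x∈vs , x-even
∈-evens⁻ x∈ | false with ∈-evens⁻ x∈
... | x∈vs , x-even = there x∈vs , x-even

∈-evens⁺ : ∀ {x vs} → x ∈ vs → isEven x ≡ true → x ∈ evens vs
∈-evens⁺ {vs = y ∷ vs} x∈ x-even with isEven y in even
∈-evens⁺ (here refl) x-even | true  = here refl
∈-evens⁺ (there x∈)  x-even | true  = there (∈-evens⁺ x∈ x-even)
∈-evens⁺ (here refl) x-even | false = contradiction (trans (sym even) x-even) λ ()
∈-evens⁺ (there x∈)  x-even | false = ∈-evens⁺ x∈ x-even

foldr-⊔-lub : ∀ {m e es} → (∀ {x} → x ∈ e ∷ es → x ≤ m) → foldr _⊔_ e es ≤ m
foldr-⊔-lub {es = []}     ≤m = ≤m (here refl)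
foldr-⊔-lub {es = y ∷ es} ≤m =
  ⊔-lub (≤m (there (here refl))) (foldr-⊔-lub λ { (here p) → ≤m (here p) ; (there p) → ≤m (there (there p)) })

∈⇒≤foldr-⊔ : ∀ {x e es} → x ∈ e ∷ es → x ≤ foldr _⊔_ e es
∈⇒≤foldr-⊔ {es = []}     (here refl)         = ≤-refl
∈⇒≤foldr-⊔ {es = y ∷ es} (here refl)         = ≤-trans (∈⇒≤foldr-⊔ {es = es} (here refl)) (m≤n⊔m y _)
∈⇒≤foldr-⊔ {es = y ∷ es} (there (here refl)) = m≤m⊔n y _
∈⇒≤foldr-⊔ {es = y ∷ es} (there (there x∈)) = ≤-trans (∈⇒≤foldr-⊔ (there x∈)) (m≤n⊔m y _)

foldr-⊓-glb : ∀ {m v vs} → m ≤ v → (∀ {x} → x ∈ vs → m ≤ x) → m ≤ foldr _⊓_ v vs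
foldr-⊓-glb {vs = []}     m≤v _  = m≤v
foldr-⊓-glb {vs = y ∷ vs} m≤v m≤ = ⊓-glb (m≤ (here refl)) (foldr-⊓-glb m≤v (m≤ ∘ there))

∈⇒foldr-⊓≤ : ∀ {x v vs} → x ∈ vs → foldr _⊓_ v vs ≤ x
∈⇒foldr-⊓≤ {vs = y ∷ vs} (here refl) = m⊓n≤m y _
∈⇒foldr-⊓≤ {vs = y ∷ vs} (there x∈)  = ≤-trans (m⊓n≤n y _) (∈⇒foldr-⊓≤ x∈)

suspenseStep-≡ : ∀ {t vs} → t ∈ vs →
                 (∀ {x} → x ∈ vs → isEven x ≡ true → x ≤ t) →
                 (isEven t ≡ false → ∀ {x} → x ∈ vs → t ≤ x) →
                 suspenseStep vs ≡ suc t
suspenseStep-≡ {t} {v ∷ vs} t∈ even≤t odd≤ with evens (v ∷ vs) in evs | isEven t in t-parity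
... | []     | true  = contradiction (subst (t ∈_) evs (∈-evens⁺ t∈ t-parity)) λ ()
... | []     | false = cong suc (≤-antisym (∈⇒foldr-⊓≤ t∈) (foldr-⊓-glb (odd≤ refl (here refl)) (odd≤ refl)))
... | e ∷ es | true  = cong suc (≤-antisym (foldr-⊔-lub even-members≤t) (∈⇒≤foldr-⊔ (subst (t ∈_) evs (∈-evens⁺ t∈ t-parity))))
  where
  even-members≤t : ∀ {x} → x ∈ e ∷ es → x ≤ t
  even-members≤t x∈ with ∈-evens⁻ (subst (_ ∈_) (sym evs) x∈)
  ... | x∈vs , x-even = even≤t x∈vs x-even
... | e ∷ es | false with ∈-evens⁻ (subst (e ∈_) (sym evs) (here refl))
...   | e∈vs , e-even = contradiction (trans (sym e-even) (trans (cong isEven e≡t) t-parity)) λ ()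
  where
  e≡t : e ≡ t
  e≡t = ≤-antisym (even≤t e∈vs e-even) (odd≤ refl e∈vs)

⊔-mono-≤-if : ∀ (P : ℕ → Set) {x y x′ y′} → (P x → x ≤ x′) → (P y → y ≤ y′) → P (x ⊔ y) → x ⊔ y ≤ x′ ⊔ y′
⊔-mono-≤-if P {x} {y} hx hy p with ⊔-sel x y
... | inj₁ x⊔y≡x = subst (_≤ _) (sym x⊔y≡x) (≤-trans (hx (subst P x⊔y≡x p)) (m≤m⊔n _ _))
... | inj₂ x⊔y≡y = subst (_≤ _) (sym x⊔y≡y) (≤-trans (hy (subst P x⊔y≡y p)) (m≤n⊔m _ _))

-- Positions valued by the maximum of a path valuation σ

module Compound (σ : ℕ → ℕ) where

  maxσ : Position → ℕ
  maxσ []       = 0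
  maxσ (c ∷ cs) = σ c ⊔ maxσ cs

  maxσ-++ : ∀ r s → maxσ (r ++ s) ≡ maxσ r ⊔ maxσ s
  maxσ-++ []      s = refl
  maxσ-++ (c ∷ r) s = trans (cong (σ c ⊔_) (maxσ-++ r s)) (sym (⊔-assoc (σ c) (maxσ r) (maxσ s)))

  maxσ-path : ∀ c → maxσ (path c) ≡ σ c
  maxσ-path c = ⊔-identityʳ (σ c)

  σ≤maxσ : ∀ {c r} → c ∈ r → σ c ≤ maxσ r
  σ≤maxσ (here refl) = m≤m⊔n _ _
  σ≤maxσ (there c∈)  = ≤-trans (σ≤maxσ c∈) (m≤n⊔m _ _)

  maxσ-lub : ∀ {r b} → (∀ {c} → c ∈ r → σ c ≤ b) → maxσ r ≤ b
  maxσ-lub {[]}    _  = z≤n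
  maxσ-lub {c ∷ r} ≤b = ⊔-lub (≤b (here refl)) (maxσ-lub (≤b ∘ there))

  Attains : List Position → ℕ → Set
  Attains L t = ∃[ o ] o ∈ L × maxσ o ≡ t

  -- The conditions under which a position with options L has suspense number suc t.
  record Optimal (t : ℕ) (L : List Position) : Set where
    field
      attained : Attains L t
      even-≤   : ∀ {o} → o ∈ L → isEven (maxσ o) ≡ true → maxσ o ≤ t
      odd-≥    : isEven t ≡ false → ∀ {o} → o ∈ L → t ≤ maxσ o

  suspenseStep-optimal : ∀ {t L} → Optimal t L → suspenseStep (map maxσ L) ≡ suc t
  suspenseStep-optimal {t} {L} opt with Optimal.attained opt
  ... | o , o∈ , refl = suspenseStep-≡ (∈-map⁺ maxσ o∈) even≤ odd≤
    where
    even≤ : ∀ {x} → x ∈ map maxσ L → isEven x ≡ true → x ≤ maxσ o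
    even≤ x∈ with ∈-map⁻ maxσ x∈
    ... | o′ , o′∈ , refl = Optimal.even-≤ opt o′∈
    odd≤ : isEven (maxσ o) ≡ false → ∀ {x} → x ∈ map maxσ L → maxσ o ≤ x
    odd≤ odd x∈ with ∈-map⁻ maxσ x∈
    ... | o′ , o′∈ , refl = Optimal.odd-≥ opt odd o′∈

  optimal-allMoves-[] : Optimal 0 (allMoves [])
  optimal-allMoves-[] = record
    { attained = [] , here refl , refl
    ; even-≤   = λ { (here refl) _ → z≤n }
    ; odd-≥    = λ ()
    }

  optimal-allMoves-∷ : ∀ {a b} k ks → Optimal a (nkMoves k) → Optimal b (allMoves ks) →
                       Optimal (a ⊔ b) (allMoves (k ∷ ks))
  optimal-allMoves-∷ {a} {b} k ks A B with Optimal.attained A | Optimal.attained B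
  ... | r , r∈ , refl | s , s∈ , refl = record
    { attained = r ++ s , ∈-allMoves⁺ k ks r∈ s∈ , maxσ-++ r s
    ; even-≤   = even-≤
    ; odd-≥    = odd-≥
    }
    where
    even-≤ : ∀ {o} → o ∈ allMoves (k ∷ ks) → isEven (maxσ o) ≡ true → maxσ o ≤ a ⊔ b
    even-≤ o∈ with ∈-allMoves⁻ k ks o∈
    ... | r′ , s′ , r′∈ , s′∈ , refl rewrite maxσ-++ r′ s′ =
      ⊔-mono-≤-if (λ x → isEven x ≡ true) (Optimal.even-≤ A r′∈) (Optimal.even-≤ B s′∈)
    odd-≥ : isEven (a ⊔ b) ≡ false → ∀ {o} → o ∈ allMoves (k ∷ ks) → a ⊔ b ≤ maxσ o
    odd-≥ odd o∈ with ∈-allMoves⁻ k ks o∈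
    ... | r′ , s′ , r′∈ , s′∈ , refl rewrite maxσ-++ r′ s′ =
      ⊔-mono-≤-if (λ x → isEven x ≡ false) (λ p → Optimal.odd-≥ A p r′∈) (λ p → Optimal.odd-≥ B p s′∈) odd

  module _ (σ-zero : σ 0 ≡ 0) (σ-pos : ∀ {k} → k ≢ 0 → 0 < σ k)
           (optimal-nkMoves : ∀ {k} → k ≢ 0 → Optimal (pred (σ k)) (nkMoves k)) where

    optimal-allMoves : ∀ {cs} → All (_≢ 0) cs → Optimal (pred (maxσ cs)) (allMoves cs)
    optimal-allMoves []                         = optimal-allMoves-[]
    optimal-allMoves {k ∷ ks} (k≢0 ∷ ks≢0) =
      subst (λ t → Optimal t (allMoves (k ∷ ks))) (sym (mono-≤-distrib-⊔ pred-mono-≤ (σ k) (maxσ ks)))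
        (optimal-allMoves-∷ k ks (optimal-nkMoves k≢0) (optimal-allMoves ks≢0))

    suspenseStep-movesOf : ∀ {cs} → All (_≢ 0) cs → suspenseStep (map maxσ (movesOf cs)) ≡ maxσ cs
    suspenseStep-movesOf []                       = refl
    suspenseStep-movesOf {k ∷ ks} cs≢0@(k≢0 ∷ _) =
      trans (suspenseStep-optimal (optimal-allMoves cs≢0))
            (suc-pred (maxσ (k ∷ ks)) {{>-nonZero (≤-trans (σ-pos k≢0) (m≤m⊔n _ _))}})

    maxσ-nonzero : ∀ G → maxσ (nonzero G) ≡ maxσ G
    maxσ-nonzero []          = refl
    maxσ-nonzero (zero ∷ G)  rewrite σ-zero = maxσ-nonzero G
    maxσ-nonzero (suc k ∷ G) = cong (σ (suc k) ⊔_) (maxσ-nonzero G)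

    suspenseF≡maxσ : ∀ f G → size G < f → suspenseF f G ≡ maxσ G
    suspenseF≡maxσ (suc f) G size<1+f = begin
      suspenseF (suc f) G                                    ≡⟨ suspenseF-suc f G ⟩
      suspenseStep (map (suspenseF f) (options G))           ≡⟨ cong (suspenseStep ∘ map (suspenseF f)) (options≡movesOf G) ⟩
      suspenseStep (map (suspenseF f) (movesOf (nonzero G))) ≡⟨ cong suspenseStep (map-cong-local (tabulate IH)) ⟩
      suspenseStep (map maxσ (movesOf (nonzero G)))          ≡⟨ suspenseStep-movesOf (all-filter (λ k → ¬? (k ≟ 0)) G) ⟩
      maxσ (nonzero G)                                       ≡⟨ maxσ-nonzero G ⟩
      maxσ G                                                 ∎
      where
      open ≡-Reasoning
      IH : ∀ {o} → o ∈ movesOf (nonzero G) → suspenseF f o ≡ maxσ o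
      IH o∈ = suspenseF≡maxσ f _ (<-≤-trans (size-movesOf (nonzero G) o∈) (≤-trans (size-nonzero G) (s≤s⁻¹ size<1+f)))

    S⁺≡maxσ : ∀ G → S⁺ G ≡ maxσ G
    S⁺≡maxσ G = suspenseF≡maxσ (suc (size G)) G ≤-refl

-- The block structure of path lengths

start : ℕ → ℕ
start zero    = 0
start (suc n) = start n + start n + 5

start-mono-≤ : ∀ {m n} → m ≤ n → start m ≤ start n
start-mono-≤ z≤n       = z≤n
start-mono-≤ (s≤s m≤n) = +-monoˡ-≤ 5 (+-mono-≤ (start-mono-≤ m≤n) (start-mono-≤ m≤n))

0<n+5 : ∀ n → 0 < n + 5
0<n+5 n = ≤-trans z<s (m≤n+m 5 n)

record Block (k : ℕ) : Set where
  constructor block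
  field
    level offset : ℕ
    start+offset : start level + offset ≡ k
    offset<      : offset < start level + 5

carry : ∀ {n d} → d < start n + 5 → ¬ suc d < start n + 5 → start (suc n) + 0 ≡ suc (start n + d)
carry {n} {d} d< d+1≮ = begin
  start n + start n + 5 + 0 ≡⟨ +-identityʳ _ ⟩
  start n + start n + 5     ≡⟨ +-assoc (start n) (start n) 5 ⟩
  start n + (start n + 5)   ≡⟨ cong (start n +_) (≤-antisym d< (≮⇒≥ d+1≮)) ⟨
  start n + suc d           ≡⟨ +-suc (start n) d ⟩
  suc (start n + d)         ∎
  where open ≡-Reasoning

toBlock : ∀ k → Block k
toBlock zero = block 0 0 refl (0<n+5 0)
toBlock (suc k) with toBlock k
... | block n d refl d< with suc d <? start n + 5
...   | yes d+1< = block n (suc d) (+-suc (start n) d) d+1<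
...   | no  d+1≮ = block (suc n) 0 (carry {n} d< d+1≮) (0<n+5 _)

level-≤ : ∀ {m d n e} → start m + d ≡ start n + e → e < start n + 5 → m ≤ n
level-≤ {m} {d} {n} {e} eq e< = ≮⇒≥ λ n<m → <-irrefl (sym eq) (begin-strict
  start n + e             <⟨ +-monoʳ-< (start n) e< ⟩
  start n + (start n + 5) ≡⟨ +-assoc (start n) (start n) 5 ⟨
  start (suc n)           ≤⟨ start-mono-≤ n<m ⟩
  start m                 ≤⟨ m≤m+n (start m) d ⟩
  start m + d             ∎)
  where open ≤-Reasoning hiding (start)

level-unique : ∀ {m d n e} → start m + d ≡ start n + e → d < start m + 5 → e < start n + 5 → m ≡ n
level-unique eq d< e< = ≤-antisym (level-≤ eq e<) (level-≤ (sym eq) d<)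

blockValue : ℕ → ℕ → ℕ
blockValue n zero    = 2 * n
blockValue n (suc d) with d ≤? start n + 2
... | yes _ = suc (2 * n)
... | no  _ = 2 * suc n

σ : ℕ → ℕ
σ k = blockValue (Block.level (toBlock k)) (Block.offset (toBlock k))

σ-block : ∀ n {d k} → start n + d ≡ k → d < start n + 5 → σ k ≡ blockValue n d
σ-block n {d} {k} eq d< with toBlock k
... | block n′ d′ eq′ d′< with level-unique {n′} {d′} {n} {d} (trans eq′ (sym eq)) d′< d<
...   | refl with +-cancelˡ-≡ (start n) d′ d (trans eq′ (sym eq))
...     | refl = refl

<+5⇒≤+3 : ∀ {d x} → suc d < x + 5 → d ≤ x + 3
<+5⇒≤+3 {d} {x} d+1< = s≤s⁻¹ (s≤s⁻¹ (≤-trans d+1< (≤-reflexive (trans (+-suc x 4) (cong suc (+-suc x 3))))))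

blockValue-middle : ∀ {n d} → 1 ≤ d → d ≤ start n + 3 → blockValue n d ≡ suc (2 * n)
blockValue-middle {n} {suc d} _ d+1≤ with d ≤? start n + 2
... | yes _  = refl
... | no d≰ = contradiction (s≤s⁻¹ (subst (suc d ≤_) (+-suc (start n) 2) d+1≤)) d≰

blockValue-last : ∀ n → blockValue n (start n + 4) ≡ 2 * suc n
blockValue-last n rewrite +-suc (start n) 3 with start n + 3 ≤? start n + 2
... | yes 3+≤2+ = contradiction (+-cancelˡ-≤ (start n) 3 2 3+≤2+) (<⇒≱ (n<1+n 2))
... | no  _     = refl

1+2n≤2[1+n] : ∀ n → suc (2 * n) ≤ 2 * suc n
1+2n≤2[1+n] n = ≤-trans (n≤1+n _) (≤-reflexive (sym (*-suc 2 n)))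

blockValue-≤-odd : ∀ {n d} → d ≤ start n + 3 → blockValue n d ≤ suc (2 * n)
blockValue-≤-odd {n} {zero}  _  = n≤1+n _
blockValue-≤-odd {n} {suc d} d≤ = ≤-reflexive (blockValue-middle (s≤s z≤n) d≤)

blockValue-≤-even : ∀ n d → blockValue n d ≤ 2 * suc n
blockValue-≤-even n zero = *-monoʳ-≤ 2 (n≤1+n n)
blockValue-≤-even n (suc d) with d ≤? start n + 2
... | yes _ = 1+2n≤2[1+n] n
... | no  _ = ≤-refl

odd≤blockValue : ∀ n d → suc (2 * n) ≤ blockValue n (suc d)
odd≤blockValue n d with d ≤? start n + 2
... | yes _ = ≤-refl
... | no  _ = 1+2n≤2[1+n] n

σ-step : ∀ {k} → Block k → σ k ≤ σ (suc k)
σ-step (block n d refl d<) with suc d <? start n + 5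
... | yes d+1< = begin
  σ (start n + d)       ≡⟨ σ-block n refl d< ⟩
  blockValue n d        ≤⟨ blockValue-≤-odd (<+5⇒≤+3 d+1<) ⟩
  suc (2 * n)           ≤⟨ odd≤blockValue n d ⟩
  blockValue n (suc d)  ≡⟨ σ-block n (+-suc (start n) d) d+1< ⟨
  σ (suc (start n + d)) ∎
  where open ≤-Reasoning hiding (start)
... | no d+1≮ = begin
  σ (start n + d)       ≡⟨ σ-block n refl d< ⟩
  blockValue n d        ≤⟨ blockValue-≤-even n d ⟩
  2 * suc n             ≡⟨ σ-block (suc n) (carry {n} d< d+1≮) (0<n+5 _) ⟨
  σ (suc (start n + d)) ∎
  where open ≤-Reasoning hiding (start)

σ-mono : ∀ {m n} → m ≤ n → σ m ≤ σ n
σ-mono = go ∘ ≤⇒≤′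
  where
  go : ∀ {m n} → m ≤′ n → σ m ≤ σ n
  go ≤′-refl            = ≤-refl
  go (≤′-step {n} m≤′n) = ≤-trans (go m≤′n) (σ-step (toBlock n))

σ-constant : ∀ {a b k v} → σ a ≡ v → σ b ≡ v → a ≤ k → k ≤ b → σ k ≡ v
σ-constant {k = k} σa≡v σb≡v a≤k k≤b =
  ≤-antisym (subst (σ k ≤_) σb≡v (σ-mono k≤b)) (subst (_≤ σ k) σa≡v (σ-mono a≤k))

σ-start : ∀ n → σ (start n) ≡ 2 * n
σ-start n = σ-block n (+-identityʳ (start n)) (0<n+5 (start n))

σ-middle : ∀ n {d} → 1 ≤ d → d ≤ start n + 3 → σ (start n + d) ≡ suc (2 * n)
σ-middle n 1≤d d≤ =
  trans (σ-block n refl (≤-<-trans d≤ (+-monoʳ-< (start n) (s<s (s<s (s<s z<s)))))) (blockValue-middle 1≤d d≤)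

σ-last : ∀ n → σ (start n + start n + 4) ≡ 2 * suc n
σ-last n = trans (σ-block n (sym (+-assoc (start n) (start n) 4)) (+-monoʳ-< (start n) (n<1+n 4))) (blockValue-last n)

σ-odd-window : ∀ n {k} → start n + 1 ≤ k → k ≤ start n + start n + 3 → σ k ≡ suc (2 * n)
σ-odd-window n = σ-constant (σ-middle n ≤-refl 1≤start+3)
                            (trans (cong σ (+-assoc (start n) (start n) 3)) (σ-middle n 1≤start+3 ≤-refl))
  where
  1≤start+3 : 1 ≤ start n + 3
  1≤start+3 = ≤-trans (s≤s z≤n) (m≤n+m 3 (start n))

σ-even-window : ∀ n {j} → start n + start n + 2 ≤ j → j ≤ start n + start n + 3 → σ (2 + j) ≡ 2 * suc n
σ-even-window n {j} j≥ j≤ = σ-constant (σ-last n) (σ-start (suc n))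
  (subst (_≤ 2 + j) (2+[x+m]≡x+m+2 2) (+-monoʳ-≤ 2 j≥))
  (subst (2 + j ≤_) (2+[x+m]≡x+m+2 3) (+-monoʳ-≤ 2 j≤))
  where
  2+[x+m]≡x+m+2 : ∀ m → 2 + (start n + start n + m) ≡ start n + start n + (m + 2)
  2+[x+m]≡x+m+2 m = trans (+-comm 2 _) (+-assoc (start n + start n) m 2)

σ-pos : ∀ {k} → k ≢ 0 → 0 < σ k
σ-pos {k} k≢0 = subst (_≤ σ k) (σ-middle 0 ≤-refl (s≤s z≤n)) (σ-mono (n≢0⇒n>0 k≢0))

data Shape : ℕ → Set where
  empty : Shape 0
  even  : ∀ n {j} → start n + start n + 2 ≤ j → j ≤ start n + start n + 3 → Shape (2 + j)
  odd   : ∀ n {d} → 1 ≤ d → d ≤ start n + 3 → Shape (start n + d)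

shapeOf : ∀ {k} → Block k → Shape k
shapeOf (block zero    zero refl _) = empty
shapeOf (block (suc n) zero refl _) =
  subst Shape (eq (start n)) (even n (+-monoʳ-≤ (start n + start n) (n≤1+n 2)) ≤-refl)
  where
  eq : ∀ x → 2 + (x + x + 3) ≡ x + x + 5 + 0
  eq = solve-∀
shapeOf (block n (suc d) refl d+1<) with d ≤? start n + 2
... | yes d≤ = odd n (s≤s z≤n) (≤-trans (s≤s d≤) (≤-reflexive (sym (+-suc (start n) 2))))
... | no  d≰ = subst Shape eq (even n ≤-refl (+-monoʳ-≤ (start n + start n) (n≤1+n 2)))
  where
  d≡ : d ≡ start n + 3
  d≡ = ≤-antisym (<+5⇒≤+3 d+1<) (≤-trans (≤-reflexive (+-suc (start n) 2)) (≰⇒> d≰))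
  eq : 2 + (start n + start n + 2) ≡ start n + suc d
  eq rewrite d≡ = lemma (start n)
    where
    lemma : ∀ x → 2 + (x + x + 2) ≡ x + suc (x + 3)
    lemma = solve-∀

shape : ∀ k → Shape k
shape k = shapeOf (toBlock k)

-- Optimality of the Node-Kayles options of a single path

open Compound σ

double-<-cancel : ∀ {m n} → m + m < n + n → m < n
double-<-cancel m+m<n+n = ≰⇒> λ n≤m → <⇒≱ m+m<n+n (+-mono-≤ n≤m n≤m)

σ-≤-odd : ∀ n {c} → c ≤ start n + start n + 3 → σ c ≤ suc (2 * n)
σ-≤-odd n c≤ = ≤-trans (σ-mono c≤) (≤-reflexive (σ-odd-window n start+1≤ ≤-refl))
  where
  start+1≤ : start n + 1 ≤ start n + start n + 3
  start+1≤ = ≤-trans (+-monoʳ-≤ (start n) (s≤s z≤n)) (+-monoˡ-≤ 3 (m≤m+n (start n) (start n)))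

maxσ-nkMoves-≤ : ∀ n {k r} → r ∈ nkMoves k → k ≤ 2 + (start n + start n + 3) → maxσ r ≤ suc (2 * n)
maxσ-nkMoves-≤ n r∈ k≤ = maxσ-lub λ c∈ → σ-≤-odd n (+-cancelˡ-≤ 2 _ _ (≤-trans (nkMoves-component r∈ c∈) k≤))

optimal-even : ∀ n {j} → start n + start n + 2 ≤ j → j ≤ start n + start n + 3 →
               Optimal (suc (2 * n)) (nkMoves (2 + j))
optimal-even n {j} j≥ j≤ = record
  { attained = path j , path∈nkMoves[2+] 2≤j , trans (maxσ-path j) (σ-odd-window n start+1≤j j≤)
  ; even-≤   = λ o∈ _ → maxσ-nkMoves-≤ n o∈ (+-monoʳ-≤ 2 j≤)
  ; odd-≥    = λ _ → odd≤
  }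
  where
  2≤j : 2 ≤ j
  2≤j = ≤-trans (m≤n+m 2 (start n + start n)) j≥
  start+1≤j : start n + 1 ≤ j
  start+1≤j = ≤-trans (+-monoˡ-≤ 1 (m≤m+n (start n) (start n))) (≤-trans (+-monoʳ-≤ _ (s≤s z≤n)) j≥)
  odd≤ : ∀ {o} → o ∈ nkMoves (2 + j) → suc (2 * n) ≤ maxσ o
  odd≤ {o} o∈ with nkMoves-large (+-monoʳ-≤ 2 2≤j) o∈
  ... | c , c∈ , 2+j≤3+2c = begin
    suc (2 * n)      ≡⟨ σ-middle n (s≤s z≤n) (≤-trans (s≤s z≤n) (m≤n+m 3 (start n))) ⟨
    σ (start n + 1)  ≤⟨ σ-mono (subst (_≤ c) (+-comm 1 (start n)) (double-<-cancel start<c)) ⟩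
    σ c              ≤⟨ σ≤maxσ c∈ ⟩
    maxσ o           ∎
    where
    open ≤-Reasoning hiding (start)
    start<c : start n + start n < c + c
    start<c = +-cancelˡ-≤ 3 _ _ (≤-trans (≤-reflexive (cong (2 +_) (+-comm 2 (start n + start n))))
                                         (≤-trans (+-monoʳ-≤ 2 j≥) 2+j≤3+2c))

odd-witness : ∀ n {d} → 1 ≤ d → d ≤ start n + 3 → Attains (nkMoves (start n + d)) (2 * n)
odd-witness zero    {1} _ _ = [] , here refl , refl
odd-witness zero    {2} _ _ = [] , here refl , refl
odd-witness zero    {3} _ _ = [] , here refl , refl
odd-witness zero    {suc (suc (suc (suc _)))} _ (s≤s (s≤s (s≤s ())))
odd-witness (suc n) {1} _ _ =
  subst (λ k → Attains (nkMoves k) (2 * suc n)) (eq (start n))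
    (path (start n + start n + 4) , path∈nkMoves[2+] (≤-trans (s≤s (s≤s z≤n)) (m≤n+m 4 _)) ,
     trans (maxσ-path (start n + start n + 4)) (σ-last n))
  where
  eq : ∀ x → 2 + (x + x + 4) ≡ x + x + 5 + 1
  eq = solve-∀
odd-witness (suc n) {2} _ _ =
  subst (λ k → Attains (nkMoves k) (2 * suc n)) (+-comm 2 (start (suc n)))
    (path (start (suc n)) , path∈nkMoves[2+] (≤-trans (s≤s (s≤s z≤n)) (m≤n+m 5 _)) ,
     trans (maxσ-path (start (suc n))) (σ-start (suc n)))
odd-witness (suc n) {3} _ _ =
  subst (λ k → Attains (nkMoves k) (2 * suc n)) (+-comm 3 (start (suc n)))
    (path (start (suc n)) , path∈nkMoves[3+] (≤-trans (s≤s z≤n) (m≤n+m 5 _)) ,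
     trans (maxσ-path (start (suc n))) (σ-start (suc n)))
odd-witness (suc n) {suc (suc (suc (suc e)))} _ d≤ =
  subst (λ k → Attains (nkMoves k) (2 * suc n)) (eq (start (suc n)) e)
    (suc e ∷ start (suc n) ∷ [] , pair∈nkMoves (s≤s z≤n) 1+e≤s , value)
  where
  eq : ∀ s e → 3 + (suc e + s) ≡ s + suc (suc (suc (suc e)))
  eq = solve-∀
  1+e≤s : suc e ≤ start (suc n)
  1+e≤s = +-cancelˡ-≤ 3 _ _ (≤-trans d≤ (≤-reflexive (+-comm (start (suc n)) 3)))
  value : maxσ (suc e ∷ start (suc n) ∷ []) ≡ 2 * suc n
  value = trans (cong (σ (suc e) ⊔_) (⊔-identityʳ _))
                (trans (m≤n⇒m⊔n≡n (σ-mono 1+e≤s)) (σ-start (suc n)))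

optimal-odd : ∀ n {d} → 1 ≤ d → d ≤ start n + 3 → Optimal (2 * n) (nkMoves (start n + d))
optimal-odd n {d} 1≤d d≤ = record
  { attained = odd-witness n 1≤d d≤
  ; even-≤   = λ o∈ even → even-≤-odd {n = n} even (maxσ-nkMoves-≤ n o∈ k≤)
  ; odd-≥    = λ odd → contradiction (trans (sym (isEven-2* n)) odd) λ ()
  }
  where
  k≤ : start n + d ≤ 2 + (start n + start n + 3)
  k≤ = ≤-trans (+-monoʳ-≤ (start n) d≤)
               (≤-trans (≤-reflexive (sym (+-assoc (start n) (start n) 3))) (m≤n+m _ 2))

optimal-path : ∀ {k} → k ≢ 0 → Optimal (pred (σ k)) (nkMoves k)
optimal-path {k} k≢0 with shape k
... | empty = contradiction refl k≢0
... | even n {j} j≥ j≤ rewrite σ-even-window n j≥ j≤ =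
  subst (λ t → Optimal t (nkMoves (2 + j))) (cong pred (sym (*-suc 2 n))) (optimal-even n j≥ j≤)
... | odd n 1≤d d≤ rewrite σ-middle n 1≤d d≤ = optimal-odd n 1≤d d≤

S⁺-path : ∀ k → S⁺ (path k) ≡ σ k
S⁺-path k = trans (S⁺≡maxσ refl σ-pos optimal-path (path k)) (maxσ-path k)

start+5≡5*2^n : ∀ n → start n + 5 ≡ 5 * 2 ^ n
start+5≡5*2^n zero    = refl
start+5≡5*2^n (suc n) = begin
  start n + start n + 5 + 5     ≡⟨ regroup (start n) ⟩
  (start n + 5) + (start n + 5) ≡⟨ cong (λ x → x + x) (start+5≡5*2^n n) ⟩
  5 * 2 ^ n + 5 * 2 ^ n         ≡⟨ double (2 ^ n) ⟩
  5 * (2 * 2 ^ n)               ∎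
  where
  open ≡-Reasoning
  regroup : ∀ x → x + x + 5 + 5 ≡ (x + 5) + (x + 5)
  regroup = solve-∀
  double : ∀ y → 5 * y + 5 * y ≡ 5 * (2 * y)
  double = solve-∀

5*[2^n∸1]≡start : ∀ n → 5 * (2 ^ n ∸ 1) ≡ start n
5*[2^n∸1]≡start n = begin
  5 * (2 ^ n ∸ 1) ≡⟨ *-distribˡ-∸ 5 (2 ^ n) 1 ⟩
  5 * 2 ^ n ∸ 5   ≡⟨ cong (_∸ 5) (start+5≡5*2^n n) ⟨
  start n + 5 ∸ 5 ≡⟨ m+n∸n≡m (start n) 5 ⟩
  start n         ∎
  where open ≡-Reasoning

start[1+n]∸2 : ∀ n → start (suc n) ∸ 2 ≡ start n + start n + 3
start[1+n]∸2 n = +-∸-assoc (start n + start n) {5} {2} (s≤s (s≤s z≤n))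

start[1+n]∸1 : ∀ n → start (suc n) ∸ 1 ≡ start n + start n + 4
start[1+n]∸1 n = +-∸-assoc (start n + start n) {5} {1} (s≤s z≤n)

theorem4 : ((m n : ℕ) → m ≤ n → S⁺ (path m) ≤ S⁺ (path n))
           × ((n : ℕ) →
                (S⁺ (path (5 * (2 ^ n ∸ 1))) ≡ 2 * n)
                × ((k : ℕ) → 5 * (2 ^ n ∸ 1) + 1 ≤ k → k ≤ 5 * (2 ^ suc n ∸ 1) ∸ 2 →
                     S⁺ (path k) ≡ 2 * n + 1)
                × (S⁺ (path (5 * (2 ^ suc n ∸ 1) ∸ 1)) ≡ 2 * n + 2))
theorem4 = S⁺-mono , λ n → S⁺-first n , S⁺-middle n , S⁺-last n
  where
  S⁺-mono : (m n : ℕ) → m ≤ n → S⁺ (path m) ≤ S⁺ (path n)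
  S⁺-mono m n m≤n = subst₂ _≤_ (sym (S⁺-path m)) (sym (S⁺-path n)) (σ-mono m≤n)

  S⁺-first : ∀ n → S⁺ (path (5 * (2 ^ n ∸ 1))) ≡ 2 * n
  S⁺-first n rewrite 5*[2^n∸1]≡start n = trans (S⁺-path (start n)) (σ-start n)

  S⁺-middle : ∀ n k → 5 * (2 ^ n ∸ 1) + 1 ≤ k → k ≤ 5 * (2 ^ suc n ∸ 1) ∸ 2 → S⁺ (path k) ≡ 2 * n + 1
  S⁺-middle n k rewrite 5*[2^n∸1]≡start n | 5*[2^n∸1]≡start (suc n) | start[1+n]∸2 n = λ k≥ k≤ →
    trans (S⁺-path k) (trans (σ-odd-window n k≥ k≤) (+-comm 1 (2 * n)))

  S⁺-last : ∀ n → S⁺ (path (5 * (2 ^ suc n ∸ 1) ∸ 1)) ≡ 2 * n + 2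
  S⁺-last n rewrite 5*[2^n∸1]≡start (suc n) | start[1+n]∸1 n =
    trans (S⁺-path (start n + start n + 4)) (trans (σ-last n) (trans (*-suc 2 n) (+-comm 2 (2 * n))))
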